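{- Let $n\geq 2$ be an integer with $n\neq 3$ and let $S$ be a sequence in $\mathbb Z_n$. Then $S$ is an $E$-extremal sequence for $(\mathbb Z_n',\{1\})$ if and only if $S$ is a translate of an $E$-extremal sequence for $\mathbb Z_n'$.
   Context: $\mathbb Z_n=\mathbb Z/n\mathbb Z$ as a module over itself and $\mathbb Z_n'=\mathbb Z_n\setminus\{0\}$. A subsequence is a non-empty subfamily of terms in the original order. For non-empty $A,B\subseteq\mathbb Z_n$, a sequence $(x_1,\ldots,x_k)$ is an $A$-weighted zero-sum sequence if there exist $a_i\in A$ with $\sum a_ix_i=0$, and an $(A,B)$-weighted zero-sum sequence if moreover there exist $b_i\in B$ with $\sum b_ia_i=0$ (for the same $a_i$). $E_{A,B}(n)$ (resp. $E_A(n)$) is the least positive $k$ such that every sequence of length $k$ in $\mathbb Z_n$ has an $(A,B)$-weighted (resp. $A$-weighted) zero-sum subsequence of length $n$. An $E$-extremal sequence for $(A,B)$ (resp. for $A$) is a sequence of length $E_{A,B}(n)-1$ (resp. $E_A(n)-1$) having no $(A,B)$-weighted (resp. $A$-weighted) zero-sum subsequence of length $n$. A translate of $(x_1,\ldots,x_k)$ is $(x_1+x,\ldots,x_k+x)$ for some $x\in\mathbb Z_n$. -}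

module Defs where

open import Data.Nat using (ℕ; zero; suc; _+_; _*_; _<_; NonZero)
open import Data.Nat.DivMod using (_%_; _mod_)
open import Data.Fin using (Fin; toℕ)
open import Data.List using (List; length; map; zipWith)
open import Data.Nat.ListAction using (sum)
open import Data.List.Relation.Unary.All using (All)
open import Data.List.Relation.Binary.Sublist.Propositional using (_⊆_)
open import Data.Product using (Σ; ∃; _×_)
open import Relation.Binary.PropositionalEquality using (_≡_; _≢_)
open import Relation.Nullary using (¬_)

ℤ_ : ℕ → Set
ℤ_ n = Fin n

module _ (n : ℕ) .{{_ : NonZero n}} where

  addZ : ℤ_ n → ℤ_ n → ℤ_ n
  addZ x y = (toℕ x + toℕ y) mod n

  wsum : List (ℤ_ n) → List (ℤ_ n) → ℕ
  wsum as xs = sum (zipWith (λ a x → toℕ a * toℕ x) as xs)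

  IsZeroZ : ℕ → Set
  IsZeroZ m = m % n ≡ 0

  Nonzero' : ℤ_ n → Set
  Nonzero' a = toℕ a ≢ 0

  One : ℤ_ n → Set
  One b = toℕ b ≡ 1 % n

  AZS : (ℤ_ n → Set) → List (ℤ_ n) → Set
  AZS A xs = Σ (List (ℤ_ n)) λ as →
    length as ≡ length xs × All A as × IsZeroZ (wsum as xs)

  ABZS : (ℤ_ n → Set) → (ℤ_ n → Set) → List (ℤ_ n) → Set
  ABZS A B xs = Σ (List (ℤ_ n)) λ as →
    length as ≡ length xs × All A as × IsZeroZ (wsum as xs) ×
    Σ (List (ℤ_ n)) (λ bs → length bs ≡ length as × All B bs × IsZeroZ (wsum bs as))

  HasSubLenN : (List (ℤ_ n) → Set) → List (ℤ_ n) → Set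
  HasSubLenN Z S = Σ (List (ℤ_ n)) λ T → T ⊆ S × length T ≡ n × Z T

  Good : (List (ℤ_ n) → Set) → ℕ → Set
  Good Z k = (S : List (ℤ_ n)) → length S ≡ k → HasSubLenN Z S

  IsE : (List (ℤ_ n) → Set) → ℕ → Set
  IsE Z k = 0 < k × Good Z k × ((j : ℕ) → 0 < j → j < k → ¬ Good Z j)

  Extremal : (List (ℤ_ n) → Set) → List (ℤ_ n) → Set
  Extremal Z S = ∃ λ k → IsE Z k × suc (length S) ≡ k × ¬ HasSubLenN Z S

  ExtremalAB : (ℤ_ n → Set) → (ℤ_ n → Set) → List (ℤ_ n) → Set
  ExtremalAB A B = Extremal (ABZS A B)

  ExtremalA : (ℤ_ n → Set) → List (ℤ_ n) → Set
  ExtremalA A = Extremal (AZS A)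

  IsTranslateOf : List (ℤ_ n) → List (ℤ_ n) → Set
  IsTranslateOf S T = ∃ λ (x : ℤ_ n) → S ≡ map (addZ x) T

module Submission where

-- With B = {1}, an (ℤ_n′, B)-weighted zero-sum is a ℤ_n′-weighted zero-sum whose weights add up to 0
-- ("balanced"), so its existence is invariant under translation.  For n = 2 and n ≥ 4 every sequence of
-- length n either has a balanced zero-sum or is, up to order, (v, c, …, c): a value repeated at least twice
-- next to two further terms, or n distinct residues, always admit balanced weights.  Hence both E-values
-- equal n + 1, as witnessed by (1, 0, …, 0), and the extremal sequences are the length-n sequences without
-- a weighted zero-sum.  Translating (v, c, …, c) by −c gives (v − c, 0, …, 0), on which any ℤ_n′-weighted
-- zero-sum becomes balanced after re-choosing the weights on the zeros; this matches the two families.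

open import Data.Nat as ℕ using (ℕ; zero; suc; NonZero; _<_; _≤_; z≤n; s≤s)
import Data.Nat.Properties as ℕ
open import Data.Nat.DivMod as ℕ using (_mod_)
import Data.Nat.Divisibility as ℕ
open import Data.Integer as ℤ using (ℤ; +_; -_; _+_; _-_; _*_)
import Data.Integer.Properties as ℤ
import Data.Integer.DivMod as ℤ
open import Data.Integer.Divisibility.Signed
  using (_∣_; _∣?_; divides; ∣ᵤ⇒∣; ∣⇒∣ᵤ; ∣m∣n⇒∣m+n; ∣m∣n⇒∣m-n; ∣m⇒∣m*n; ∣n⇒∣m*n; ∣m⇒∣-m)
open import Data.Integer.Tactic.RingSolver using (solve-∀)
open import Data.Fin as Fin using (Fin; toℕ; fromℕ; fromℕ<)
import Data.Fin.Properties as Fin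
open import Data.List as List using (List; []; _∷_; [_]; length; replicate; _++_; map; foldr; take)
import Data.List.Properties as List
open import Data.List.Membership.Propositional using (_∈_; _∉_)
open import Data.List.Membership.Propositional.Properties using (∈-∃++; ∈-allFin)
import Data.List.Membership.DecPropositional as DecMembership
open import Data.List.Relation.Unary.All as All using (All; []; _∷_)
import Data.List.Relation.Unary.All.Properties as All
open import Data.List.Relation.Unary.Any using (here; there)
open import Data.List.Relation.Unary.Unique.Propositional using (Unique; []; _∷_)
open import Data.List.Relation.Binary.Pointwise as Pointwise using (Pointwise; []; _∷_)
open import Data.List.Relation.Binary.Permutation.Propositional as ↭
  using (_↭_; prep; swap; ↭-sym; ↭⇒↭ₛ′)
import Data.List.Relation.Binary.Permutation.Propositional.Properties as ↭
import Data.List.Relation.Binary.Permutation.Setoid.Properties as ↭ₛ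
open import Data.List.Relation.Binary.Sublist.Propositional as ⊆ using (_⊆_; []; _∷_; _∷ʳ_; ⊆-refl; ⊆-trans)
import Data.List.Relation.Binary.Sublist.Propositional.Properties as ⊆
open import Data.List.Relation.Binary.Equality.Propositional using (≋⇒≡)
open import Data.Product using (Σ-syntax; ∃; ∃₂; _×_; _,_; proj₁)
open import Data.Sum using (_⊎_; inj₁; inj₂)
open import Function using (_∘_)
open import Function.Bundles using (_⇔_; mk⇔; Equivalence)
open import Level using (0ℓ)
open import Relation.Binary.Bundles using (Setoid)
open import Relation.Binary.Definitions using (DecidableEquality; tri<; tri≈; tri>)
open import Relation.Binary.PropositionalEquality
  using (_≡_; _≢_; refl; sym; trans; cong; cong₂; subst; setoid; isEquivalence; module ≡-Reasoning)
import Relation.Binary.Reasoning.Setoid as SetoidReasoning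
open import Relation.Nullary using (¬_; yes; no; contradiction)

open import Defs

module _ {A : Set} where

  ∈⇒⊆×↭ : ∀ {x : A} {xs} → x ∈ xs → ∃ λ ys → ys ⊆ xs × xs ↭ x ∷ ys
  ∈⇒⊆×↭ {x} x∈xs with ys , zs , refl ← ∈-∃++ x∈xs =
    ys ++ zs , ⊆.++⁺ ⊆-refl (x ∷ʳ ⊆-refl) , ↭.shift x ys zs

  ∈-↭∷⁻ : ∀ {x y : A} {xs ys} → xs ↭ x ∷ ys → y ∈ xs → y ≢ x → y ∈ ys
  ∈-↭∷⁻ p y∈xs y≢x with ↭.∈-resp-↭ p y∈xs
  ... | here y≡x = contradiction y≡x y≢x
  ... | there y∈ys = y∈ys

  Unique-resp-↭ : ∀ {xs ys : List A} → xs ↭ ys → Unique xs → Unique ys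
  Unique-resp-↭ p = ↭ₛ.Unique-resp-↭ (setoid A) (↭⇒↭ₛ′ isEquivalence p)

  ⊆∧length≡⇒≡ : ∀ {xs ys : List A} → xs ⊆ ys → length xs ≡ length ys → xs ≡ ys
  ⊆∧length≡⇒≡ xs⊆ys eq = ≋⇒≡ (⊆.to-≋ eq xs⊆ys)

  All-∈-↭∷⁻ : ∀ {x : A} {xs ys ys′} → ys ↭ x ∷ ys′ → All (x ≢_) xs → All (_∈ ys) xs → All (_∈ ys′) xs
  All-∈-↭∷⁻ p x≢xs xs∈ys = All.zipWith (λ (x≢y , y∈ys) → ∈-↭∷⁻ p y∈ys (λ y≡x → x≢y (sym y≡x))) (x≢xs , xs∈ys)

  unique⇒length≤ : ∀ {xs ys : List A} → Unique xs → All (_∈ ys) xs → length xs ≤ length ys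
  unique⇒length≤ [] [] = z≤n
  unique⇒length≤ (x∉xs ∷ u) (x∈ys ∷ xs⊆ys) with _ , _ , p ← ∈⇒⊆×↭ x∈ys =
    ℕ.≤-trans (s≤s (unique⇒length≤ u (All-∈-↭∷⁻ p x∉xs xs⊆ys))) (ℕ.≤-reflexive (sym (↭.↭-length p)))

  extract-unique : ∀ {xs ys : List A} → Unique ys → Unique xs → All (_∈ ys) xs →
                   ∃ λ zs → ys ↭ xs ++ zs × All (_∉ xs) zs
  extract-unique uys [] [] = _ , ↭.↭-refl , All.universal (λ _ ()) _
  extract-unique {x ∷ xs} uys (x∉xs ∷ uxs) (x∈ys ∷ xs⊆ys)
    with ys′ , _ , p ← ∈⇒⊆×↭ x∈ys
    with x∉ys′ ∷ uys′ ← Unique-resp-↭ p uys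
    with zs , q , zs∉xs ← extract-unique uys′ uxs (All-∈-↭∷⁻ p x∉xs xs⊆ys)
    = zs , ↭.trans p (prep x q) ,
      All.zipWith (λ { (x≢z , z∉xs) (here z≡x) → x≢z (sym z≡x) ; (_ , z∉xs) (there z∈xs) → z∉xs z∈xs })
        (All.++⁻ʳ xs (↭.All-resp-↭ q x∉ys′) , zs∉xs)

module _ {A : Set} (_≟_ : DecidableEquality A) where

  open DecMembership _≟_ using (_∈?_)

  unique-or-duplicate : (xs : List A) → Unique xs ⊎ ∃₂ λ d ys → xs ↭ d ∷ d ∷ ys
  unique-or-duplicate [] = inj₁ []
  unique-or-duplicate (x ∷ xs) with x ∈? xs
  ... | yes x∈xs with ys , _ , p ← ∈⇒⊆×↭ x∈xs = inj₂ (x , ys , prep x p)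
  ... | no x∉xs with unique-or-duplicate xs
  ...   | inj₁ u = inj₁ (All.¬Any⇒All¬ xs x∉xs ∷ u)
  ...   | inj₂ (d , ys , p) = inj₂ (d , x ∷ ys , ↭.trans (prep x p) (↭.shifts [ x ] (d ∷ d ∷ [])))

  ↭-replicate-++ : (d : A) (xs : List A) → ∃₂ λ k ys → xs ↭ replicate k d ++ ys × All (_≢ d) ys
  ↭-replicate-++ d [] = 0 , [] , ↭.↭-refl , []
  ↭-replicate-++ d (x ∷ xs) with ↭-replicate-++ d xs | x ≟ d
  ... | k , ys , p , ys≢d | yes refl = suc k , ys , prep x p , ys≢d
  ... | k , ys , p , ys≢d | no x≢d =
    k , x ∷ ys , ↭.trans (prep x p) (↭-sym (↭.shift x (replicate k d) ys)) , x≢d ∷ ys≢d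

unique⇒complete : ∀ {n} {xs : List (Fin n)} → Unique xs → length xs ≡ n → (v : Fin n) → v ∈ xs
unique⇒complete {n} {xs} u len v with v ∈? xs
  where open DecMembership Fin._≟_
... | yes v∈xs = v∈xs
... | no v∉xs = contradiction
  (unique⇒length≤ (All.¬Any⇒All¬ xs v∉xs ∷ u) (All.universal ∈-allFin (v ∷ xs)))
  (ℕ.<-irrefl (trans len (sym (List.length-tabulate {n = n} (λ i → i)))))

map-cancelˡ : ∀ {A B : Set} {f : A → B} {g : B → A} → (∀ x → g (f x) ≡ x) →
              ∀ xs → map g (map f xs) ≡ xs
map-cancelˡ g∘f≗id xs = trans (sym (List.map-∘ xs)) (trans (List.map-cong g∘f≗id xs) (List.map-id xs))

module Residues (n : ℕ) .{{_ : NonZero n}} where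

  N : ℤ
  N = + n

  infix 4 _≡ₙ_
  record _≡ₙ_ (a b : ℤ) : Set where
    constructor ≡ₙ-intro
    field N∣a-b : N ∣ a - b

  N∣0 : N ∣ + 0
  N∣0 = divides (+ 0) refl

  ≡⇒≡ₙ : ∀ {a b} → a ≡ b → a ≡ₙ b
  ≡⇒≡ₙ {a} refl = ≡ₙ-intro (subst (N ∣_) (sym (ℤ.+-inverseʳ a)) N∣0)

  ≡ₙ-refl : ∀ {a} → a ≡ₙ a
  ≡ₙ-refl = ≡⇒≡ₙ refl

  ≡ₙ-sym : ∀ {a b} → a ≡ₙ b → b ≡ₙ a
  ≡ₙ-sym {a} {b} (≡ₙ-intro d) = ≡ₙ-intro (subst (N ∣_) (lemma a b) (∣m⇒∣-m d))
    where lemma : ∀ a b → - (a - b) ≡ b - a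
          lemma = solve-∀

  ≡ₙ-trans : ∀ {a b c} → a ≡ₙ b → b ≡ₙ c → a ≡ₙ c
  ≡ₙ-trans {a} {b} {c} (≡ₙ-intro d) (≡ₙ-intro e) = ≡ₙ-intro (subst (N ∣_) (lemma a b c) (∣m∣n⇒∣m+n d e))
    where lemma : ∀ a b c → (a - b) + (b - c) ≡ a - c
          lemma = solve-∀

  +-cong : ∀ {a b c d} → a ≡ₙ b → c ≡ₙ d → a + c ≡ₙ b + d
  +-cong {a} {b} {c} {d} (≡ₙ-intro p) (≡ₙ-intro q) = ≡ₙ-intro (subst (N ∣_) (lemma a b c d) (∣m∣n⇒∣m+n p q))
    where lemma : ∀ a b c d → (a - b) + (c - d) ≡ (a + c) - (b + d)
          lemma = solve-∀

  *-cong : ∀ {a b c d} → a ≡ₙ b → c ≡ₙ d → a * c ≡ₙ b * d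
  *-cong {a} {b} {c} {d} (≡ₙ-intro p) (≡ₙ-intro q) =
    ≡ₙ-intro (subst (N ∣_) (lemma a b c d) (∣m∣n⇒∣m+n (∣n⇒∣m*n a q) (∣n⇒∣m*n d p)))
    where lemma : ∀ a b c d → a * (c - d) + d * (a - b) ≡ a * c - b * d
          lemma = solve-∀

  ∣-resp-≡ₙ : ∀ {a b} → a ≡ₙ b → N ∣ a → N ∣ b
  ∣-resp-≡ₙ {a} {b} (≡ₙ-intro d) e = subst (N ∣_) (lemma a b) (∣m∣n⇒∣m+n e (∣m⇒∣-m d))
    where lemma : ∀ a b → a + - (a - b) ≡ b
          lemma = solve-∀

  +-multiple : ∀ a k → a + k * N ≡ₙ a
  +-multiple a k = ≡ₙ-intro (subst (N ∣_) (lemma a k N) (divides k refl))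
    where lemma : ∀ a k N → k * N ≡ (a + k * N) - a
          lemma = solve-∀

  ≡ₙ-setoid : Setoid 0ℓ 0ℓ
  ≡ₙ-setoid = record
    { Carrier       = ℤ
    ; _≈_           = _≡ₙ_
    ; isEquivalence = record { refl = ≡ₙ-refl ; sym = ≡ₙ-sym ; trans = ≡ₙ-trans }
    }

  module ≡ₙ-Reasoning = SetoidReasoning ≡ₙ-setoid

  Nonzeroₙ : ℤ → Set
  Nonzeroₙ w = ¬ N ∣ w

  Nonzeroₙ-neg : ∀ {a} → Nonzeroₙ a → Nonzeroₙ (- a)
  Nonzeroₙ-neg {a} a≢0 d = a≢0 (subst (N ∣_) (ℤ.neg-involutive a) (∣m⇒∣-m d))

  Nonzeroₙ-+ : ∀ {k} → 0 ℕ.< k → k ℕ.< n → Nonzeroₙ (+ k)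
  Nonzeroₙ-+ {suc k} _ k<n d = ℕ.>⇒∤ k<n (∣⇒∣ᵤ d)

  1≢0 : 1 ℕ.< n → Nonzeroₙ (+ 1)
  1≢0 = Nonzeroₙ-+ (s≤s z≤n)

  2≢0 : 2 ℕ.< n → Nonzeroₙ (+ 2)
  2≢0 = Nonzeroₙ-+ (s≤s z≤n)

  ⟦_⟧ : Fin n → ℤ
  ⟦ x ⟧ = + toℕ x

  private
    ≡ₙ⇒≡-≤ : ∀ {a b} → a ℕ.< n → b ℕ.≤ a → + a ≡ₙ + b → a ≡ b
    ≡ₙ⇒≡-≤ {a} {b} a<n b≤a (≡ₙ-intro d) with a ℕ.∸ b in a∸b
    ... | zero = ℕ.≤-antisym (ℕ.m∸n≡0⇒m≤n a∸b) b≤a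
    ... | suc k = contradiction
      (∣⇒∣ᵤ (subst (N ∣_) (trans (ℤ.m-n≡m⊖n a b) (trans (ℤ.⊖-≥ b≤a) (cong +_ a∸b))) d))
      (ℕ.>⇒∤ (ℕ.≤-<-trans (subst (ℕ._≤ a) a∸b (ℕ.m∸n≤m a b)) a<n))

  ≡ₙ⇒≡ : ∀ {a b} → a ℕ.< n → b ℕ.< n → + a ≡ₙ + b → a ≡ b
  ≡ₙ⇒≡ {a} {b} a<n b<n a≡b with ℕ.≤-total b a
  ... | inj₁ b≤a = ≡ₙ⇒≡-≤ a<n b≤a a≡b
  ... | inj₂ a≤b = sym (≡ₙ⇒≡-≤ b<n a≤b (≡ₙ-sym a≡b))

  ⟦⟧-injective : ∀ {x y} → ⟦ x ⟧ ≡ₙ ⟦ y ⟧ → x ≡ y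
  ⟦⟧-injective {x} {y} x≡y = Fin.toℕ-injective (≡ₙ⇒≡ (Fin.toℕ<n x) (Fin.toℕ<n y) x≡y)

  ⟦mod⟧ : ∀ k → ⟦ k ℕ.mod n ⟧ ≡ₙ + k
  ⟦mod⟧ k rewrite Fin.toℕ-fromℕ< (ℕ.m%n<n k n) =
    ≡ₙ-sym (subst (_≡ₙ + (k ℕ.% n)) k≡ (+-multiple (+ (k ℕ.% n)) (+ (k ℕ./ n))))
    where k≡ : + (k ℕ.% n) + + (k ℕ./ n) * N ≡ + k
          k≡ = begin
            + (k ℕ.% n) + + (k ℕ./ n) * N   ≡⟨ cong (λ q → + (k ℕ.% n) + q) (ℤ.pos-* (k ℕ./ n) n) ⟨
            + (k ℕ.% n) + + (k ℕ./ n ℕ.* n) ≡⟨ ℤ.pos-+ (k ℕ.% n) _ ⟨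
            + (k ℕ.% n ℕ.+ k ℕ./ n ℕ.* n)   ≡⟨ cong +_ (ℕ.m≡m%n+[m/n]*n k n) ⟨
            + k                             ∎
            where open ≡-Reasoning

  ⟦addZ⟧ : ∀ x y → ⟦ addZ n x y ⟧ ≡ₙ ⟦ x ⟧ + ⟦ y ⟧
  ⟦addZ⟧ x y = ≡ₙ-trans (⟦mod⟧ (toℕ x ℕ.+ toℕ y)) (≡⇒≡ₙ (ℤ.pos-+ (toℕ x) (toℕ y)))

  residue : ℤ → Fin n
  residue w = fromℕ< (ℤ.n%ℕd<d w n)

  ⟦residue⟧ : ∀ w → ⟦ residue w ⟧ ≡ₙ w
  ⟦residue⟧ w rewrite Fin.toℕ-fromℕ< (ℤ.n%ℕd<d w n) =
    subst (+ (w ℤ.%ℕ n) ≡ₙ_) (sym (ℤ.a≡a%ℕn+[a/ℕn]*n w n)) (≡ₙ-sym (+-multiple (+ (w ℤ.%ℕ n)) (w ℤ./ℕ n)))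

  neg : Fin n → Fin n
  neg x = residue (- ⟦ x ⟧)

  addZ-neg-cancelˡ : ∀ x y → addZ n (neg x) (addZ n x y) ≡ y
  addZ-neg-cancelˡ x y = ⟦⟧-injective {addZ n (neg x) (addZ n x y)} {y} (begin
    ⟦ addZ n (neg x) (addZ n x y) ⟧ ≈⟨ ⟦addZ⟧ (neg x) (addZ n x y) ⟩
    ⟦ neg x ⟧ + ⟦ addZ n x y ⟧      ≈⟨ +-cong (⟦residue⟧ (- ⟦ x ⟧)) (⟦addZ⟧ x y) ⟩
    - ⟦ x ⟧ + (⟦ x ⟧ + ⟦ y ⟧)       ≡⟨ lemma ⟦ x ⟧ ⟦ y ⟧ ⟩
    ⟦ y ⟧                           ∎)
    where open ≡ₙ-Reasoning
          lemma : ∀ a b → - a + (a + b) ≡ b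
          lemma = solve-∀

  addZ-neg-cancelʳ : ∀ x y → addZ n x (addZ n (neg x) y) ≡ y
  addZ-neg-cancelʳ x y = ⟦⟧-injective {addZ n x (addZ n (neg x) y)} {y} (begin
    ⟦ addZ n x (addZ n (neg x) y) ⟧ ≈⟨ ⟦addZ⟧ x (addZ n (neg x) y) ⟩
    ⟦ x ⟧ + ⟦ addZ n (neg x) y ⟧    ≈⟨ +-cong (≡ₙ-refl {⟦ x ⟧}) (⟦addZ⟧ (neg x) y) ⟩
    ⟦ x ⟧ + (⟦ neg x ⟧ + ⟦ y ⟧)     ≈⟨ +-cong (≡ₙ-refl {⟦ x ⟧}) (+-cong (⟦residue⟧ (- ⟦ x ⟧)) ≡ₙ-refl) ⟩
    ⟦ x ⟧ + (- ⟦ x ⟧ + ⟦ y ⟧)       ≡⟨ lemma ⟦ x ⟧ ⟦ y ⟧ ⟩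
    ⟦ y ⟧                           ∎)
    where open ≡ₙ-Reasoning
          lemma : ∀ a b → a + (- a + b) ≡ b
          lemma = solve-∀

module ZeroSums (n : ℕ) .{{_ : NonZero n}} where

  open Residues n

  infix 7 _·_
  _·_ : List ℤ → List ℤ → ℤ
  (w ∷ ws) · (d ∷ ds) = w * d + ws · ds
  _ · _ = + 0

  ∑ : List ℤ → ℤ
  ∑ = foldr _+_ (+ 0)

  ·-comm : ∀ ws ds → ws · ds ≡ ds · ws
  ·-comm []       []       = refl
  ·-comm []       (d ∷ ds) = refl
  ·-comm (w ∷ ws) []       = refl
  ·-comm (w ∷ ws) (d ∷ ds) = cong₂ _+_ (ℤ.*-comm w d) (·-comm ws ds)

  ·-replicate : ∀ ws {k} d → length ws ≡ k → ws · replicate k d ≡ ∑ ws * d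
  ·-replicate []       d refl = refl
  ·-replicate (w ∷ ws) d refl =
    trans (cong (λ s → w * d + s) (·-replicate ws d refl)) (sym (ℤ.*-distribʳ-+ d w (∑ ws)))

  ·-++ : ∀ ws vs ds es → length ws ≡ length ds → (ws ++ vs) · (ds ++ es) ≡ ws · ds + vs · es
  ·-++ []       vs []       es eq = sym (ℤ.+-identityˡ _)
  ·-++ (w ∷ ws) vs (d ∷ ds) es eq =
    trans (cong (λ s → w * d + s) (·-++ ws vs ds es (ℕ.suc-injective eq))) (sym (ℤ.+-assoc (w * d) _ _))

  ∑-++ : ∀ ws vs → ∑ (ws ++ vs) ≡ ∑ ws + ∑ vs
  ∑-++ []       vs = sym (ℤ.+-identityˡ _)
  ∑-++ (w ∷ ws) vs = trans (cong (λ s → w + s) (∑-++ ws vs)) (sym (ℤ.+-assoc w _ _))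

  ∑-↭ : ∀ {ws vs} → ws ↭ vs → ∑ ws ≡ ∑ vs
  ∑-↭ ↭.refl           = refl
  ∑-↭ (prep w p)       = cong (λ s → w + s) (∑-↭ p)
  ∑-↭ (swap v w p)     = trans (cong (λ s → v + (w + s)) (∑-↭ p)) (lemma v w _)
    where lemma : ∀ a b c → a + (b + c) ≡ b + (a + c)
          lemma = solve-∀
  ∑-↭ (↭.trans p q)    = trans (∑-↭ p) (∑-↭ q)

  ·-↭ : ∀ {ds es} → ds ↭ es → ∀ ws → length ws ≡ length ds →
        ∃ λ vs → ws ↭ vs × vs · es ≡ ws · ds
  ·-↭ ↭.refl ws eq = ws , ↭.refl , refl
  ·-↭ (prep d p) (w ∷ ws) eq with vs , q , e ← ·-↭ p ws (ℕ.suc-injective eq) =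
    w ∷ vs , prep w q , cong (λ s → w * d + s) e
  ·-↭ (swap d e p) (v ∷ w ∷ ws) eq with vs , q , f ← ·-↭ p ws (ℕ.suc-injective (ℕ.suc-injective eq)) =
    w ∷ v ∷ vs , swap v w q , trans (cong (λ s → w * e + (v * d + s)) f) (lemma (w * e) (v * d) (ws · _))
    where lemma : ∀ a b c → a + (b + c) ≡ b + (a + c)
          lemma = solve-∀
  ·-↭ (↭.trans p q) ws eq
    with vs , r , e ← ·-↭ p ws eq
    with us , s , f ← ·-↭ q vs (trans (↭.↭-length (↭-sym r)) (trans eq (↭.↭-length p))) =
    us , ↭.trans r s , trans f e

  ·-translate : ∀ ws ds t → length ws ≡ length ds → ws · map (_+_ t) ds ≡ ws · ds + t * ∑ ws
  ·-translate []       []       t eq = sym (trans (ℤ.+-identityˡ _) (ℤ.*-zeroʳ t))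
  ·-translate (w ∷ ws) (d ∷ ds) t eq =
    trans (cong (λ s → w * (t + d) + s) (·-translate ws ds t (ℕ.suc-injective eq)))
          (lemma w t d (ws · ds) (∑ ws))
    where lemma : ∀ w t d z s → w * (t + d) + (z + t * s) ≡ (w * d + z) + t * (w + s)
          lemma = solve-∀

  ·-cong : ∀ {ws vs ds es} → Pointwise _≡ₙ_ ws vs → Pointwise _≡ₙ_ ds es → ws · ds ≡ₙ vs · es
  ·-cong []          _           = ≡ₙ-refl
  ·-cong (_ ∷ _)     []          = ≡ₙ-refl
  ·-cong (w≡v ∷ ws≡vs) (d≡e ∷ ds≡es) = +-cong (*-cong w≡v d≡e) (·-cong ws≡vs ds≡es)

  ∑-cong : ∀ {ws vs} → Pointwise _≡ₙ_ ws vs → ∑ ws ≡ₙ ∑ vs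
  ∑-cong []            = ≡ₙ-refl
  ∑-cong (w≡v ∷ ws≡vs) = +-cong w≡v (∑-cong ws≡vs)

  -- Weights range over integers not divisible by n, representing ℤ_n′; Balanced adds the condition
  -- of an (ℤ_n′, {1})-weighted zero-sum, that the weights themselves sum to zero.
  record ZeroSum (ds : List ℤ) : Set where
    constructor zeroSum
    field
      weights        : List ℤ
      length-weights : length weights ≡ length ds
      weights≢0      : All Nonzeroₙ weights
      N∣weights·ds   : N ∣ weights · ds

  open ZeroSum public

  Balanced : List ℤ → Set
  Balanced ds = Σ[ z ∈ ZeroSum ds ] N ∣ ∑ (weights z)

  ZeroSum-↭ : ∀ {ds es} → ds ↭ es → (z : ZeroSum ds) → Σ[ z′ ∈ ZeroSum es ] weights z ↭ weights z′
  ZeroSum-↭ p (zeroSum ws len ws≢0 N∣) with vs , q , e ← ·-↭ p ws len =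
    zeroSum vs (trans (sym (↭.↭-length q)) (trans len (↭.↭-length p))) (↭.All-resp-↭ q ws≢0)
            (subst (N ∣_) (sym e) N∣) ,
    q

  Balanced-↭ : ∀ {ds es} → ds ↭ es → Balanced ds → Balanced es
  Balanced-↭ p (z , N∣∑) with z′ , q ← ZeroSum-↭ p z = z′ , subst (N ∣_) (∑-↭ q) N∣∑

  ZeroSum-cong : ∀ {ds es} → Pointwise _≡ₙ_ ds es → ZeroSum ds → ZeroSum es
  ZeroSum-cong ds≡es (zeroSum ws len ws≢0 N∣) =
    zeroSum ws (trans len (Pointwise.Pointwise-length ds≡es)) ws≢0
            (∣-resp-≡ₙ (·-cong (Pointwise.refl ≡ₙ-refl {ws}) ds≡es) N∣)

  Balanced-cong : ∀ {ds es} → Pointwise _≡ₙ_ ds es → Balanced ds → Balanced es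
  Balanced-cong ds≡es (z , N∣∑) = ZeroSum-cong ds≡es z , N∣∑

  Balanced-translate : ∀ t {ds} → Balanced ds → Balanced (map (_+_ t) ds)
  Balanced-translate t {ds} (zeroSum ws len ws≢0 N∣ , N∣∑) =
    zeroSum ws (trans len (sym (List.length-map _ ds))) ws≢0
            (subst (N ∣_) (sym (·-translate ws ds t len)) (∣m∣n⇒∣m+n N∣ (∣n⇒∣m*n t N∣∑))) ,
    N∣∑

  ZeroSum-++ : ∀ {ds es} → ZeroSum ds → ZeroSum es → ZeroSum (ds ++ es)
  ZeroSum-++ {ds} {es} (zeroSum ws len ws≢0 N∣) (zeroSum vs len′ vs≢0 N∣′) =
    zeroSum (ws ++ vs) (trans (List.length-++ ws) (trans (cong₂ ℕ._+_ len len′) (sym (List.length-++ ds))))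
            (All.++⁺ ws≢0 vs≢0) (subst (N ∣_) (sym (·-++ ws vs ds es len)) (∣m∣n⇒∣m+n N∣ N∣′))

  SumOfNonzero : ℕ → ℤ → Set
  SumOfNonzero ℓ t = ∃ λ fs → length fs ≡ ℓ × All Nonzeroₙ fs × ∑ fs ≡ t

  ∑-replicate-1 : ∀ k → ∑ (replicate k (+ 1)) ≡ + k
  ∑-replicate-1 zero    = refl
  ∑-replicate-1 (suc k) = trans (cong (λ s → + 1 + s) (∑-replicate-1 k)) (sym (ℤ.pos-+ 1 k))

  ZeroSum-pair : ∀ {d e} → Nonzeroₙ d → Nonzeroₙ e → ZeroSum (d ∷ e ∷ [])
  ZeroSum-pair {d} {e} d≢0 e≢0 =
    zeroSum (e ∷ - d ∷ []) refl (e≢0 ∷ Nonzeroₙ-neg d≢0 ∷ []) (subst (N ∣_) (sym (lemma d e)) N∣0)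
    where lemma : ∀ d e → e * d + (- d * e + + 0) ≡ + 0
          lemma = solve-∀

  ZeroSum-triple′ : ∀ {d e f} → Nonzeroₙ d → Nonzeroₙ (e + f) → ZeroSum (d ∷ e ∷ f ∷ [])
  ZeroSum-triple′ {d} {e} {f} d≢0 e+f≢0 =
    zeroSum (e + f ∷ - d ∷ - d ∷ []) refl (e+f≢0 ∷ Nonzeroₙ-neg d≢0 ∷ Nonzeroₙ-neg d≢0 ∷ [])
            (subst (N ∣_) (sym (lemma d e f)) N∣0)
    where lemma : ∀ d e f → (e + f) * d + (- d * e + (- d * f + + 0)) ≡ + 0
          lemma = solve-∀

  ZeroSum-∷-zeros⁻ : ∀ {d k} → ZeroSum (d ∷ replicate k (+ 0)) → ZeroSum (d ∷ [])
  ZeroSum-∷-zeros⁻ {d} {k} (zeroSum (a ∷ ws) len (a≢0 ∷ _) N∣) =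
    zeroSum (a ∷ []) refl (a≢0 ∷ []) (subst (N ∣_) (cong (λ s → a * d + s) ws·0≡0) N∣)
    where ws·0≡0 : ws · replicate k (+ 0) ≡ + 0
          ws·0≡0 = trans (·-replicate ws (+ 0) (trans (ℕ.suc-injective len) (List.length-replicate k)))
                         (ℤ.*-zeroʳ (∑ ws))

  ¬ZeroSum-1∷zeros : ∀ k → ¬ ZeroSum (+ 1 ∷ replicate k (+ 0))
  ¬ZeroSum-1∷zeros k z with zeroSum (a ∷ []) _ (a≢0 ∷ []) N∣ ← ZeroSum-∷-zeros⁻ z =
    a≢0 (subst (N ∣_) (trans (ℤ.+-identityʳ (a * + 1)) (ℤ.*-identityʳ a)) N∣)

  Balanced-replicate : 1 ℕ.< n → ∀ d → Balanced (replicate n d)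
  Balanced-replicate 1<n d =
    zeroSum ones (trans (List.length-replicate n) (sym (List.length-replicate n)))
            (All.replicate⁺ n (1≢0 1<n))
            (subst (N ∣_) (sym (trans (·-replicate ones d (List.length-replicate n))
                                      (cong (_* d) (∑-replicate-1 n))))
                   (∣m⇒∣m*n d (divides (+ 1) (sym (ℤ.*-identityˡ N))))) ,
    subst (N ∣_) (sym (∑-replicate-1 n)) (divides (+ 1) (sym (ℤ.*-identityˡ N)))
    where ones = replicate n (+ 1)

  Balanced-zeros-++ : ∀ {k ds} (z : ZeroSum ds) → SumOfNonzero k (- ∑ (weights z)) →
                      Balanced (replicate k (+ 0) ++ ds)
  Balanced-zeros-++ {k} {ds} (zeroSum gs len gs≢0 N∣) (fs , len-fs , fs≢0 , ∑fs) =
    zeroSum (fs ++ gs)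
      (trans (List.length-++ fs) (trans (cong₂ ℕ._+_ |fs|≡k len)
                                        (sym (List.length-++ (replicate k (+ 0))))))
      (All.++⁺ fs≢0 gs≢0)
      (subst (N ∣_) (sym dot) N∣) ,
    subst (N ∣_) (sym ∑≡0) N∣0
    where
      open ≡-Reasoning
      |fs|≡k : length fs ≡ length (replicate k (+ 0))
      |fs|≡k = trans len-fs (sym (List.length-replicate k))
      dot : (fs ++ gs) · (replicate k (+ 0) ++ ds) ≡ gs · ds
      dot = begin
        (fs ++ gs) · (replicate k (+ 0) ++ ds) ≡⟨ ·-++ fs gs _ ds |fs|≡k ⟩
        fs · replicate k (+ 0) + gs · ds      ≡⟨ cong (_+ gs · ds) (·-replicate fs (+ 0) len-fs) ⟩
        ∑ fs * + 0 + gs · ds                  ≡⟨ cong (_+ gs · ds) (ℤ.*-zeroʳ (∑ fs)) ⟩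
        + 0 + gs · ds                         ≡⟨ ℤ.+-identityˡ (gs · ds) ⟩
        gs · ds                               ∎
      ∑≡0 : ∑ (fs ++ gs) ≡ + 0
      ∑≡0 = begin
        ∑ (fs ++ gs)    ≡⟨ ∑-++ fs gs ⟩
        ∑ fs + ∑ gs     ≡⟨ cong (_+ ∑ gs) ∑fs ⟩
        - ∑ gs + ∑ gs   ≡⟨ ℤ.+-inverseˡ (∑ gs) ⟩
        + 0             ∎

  Balanced-∷-zeros : ∀ {d k} → (∀ t → Nonzeroₙ t → SumOfNonzero k t) →
                     ZeroSum (d ∷ replicate k (+ 0)) → Balanced (d ∷ replicate k (+ 0))
  Balanced-∷-zeros {d} {k} decompose z with z′@(zeroSum (a ∷ []) _ (a≢0 ∷ []) _) ← ZeroSum-∷-zeros⁻ z =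
    Balanced-↭ (↭.++-comm (replicate k (+ 0)) (d ∷ []))
      (Balanced-zeros-++ z′ (decompose _ (subst (λ b → Nonzeroₙ (- b)) (sym (ℤ.+-identityʳ a))
                                                (Nonzeroₙ-neg a≢0))))

  Balanced-0∷1∷-1∷′ : ∀ {ds} (z : ZeroSum ds) l → Nonzeroₙ l → Nonzeroₙ (l + l + ∑ (weights z)) →
                      Balanced (+ 0 ∷ + 1 ∷ ℤ.-1ℤ ∷ ds)
  Balanced-0∷1∷-1∷′ {ds} (zeroSum gs len gs≢0 N∣) l l≢0 w₀≢0 =
    zeroSum (- (l + l + ∑ gs) ∷ l ∷ l ∷ gs) (cong (λ k → suc (suc (suc k))) len)
            (Nonzeroₙ-neg w₀≢0 ∷ l≢0 ∷ l≢0 ∷ gs≢0)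
            (subst (N ∣_) (sym (dot l (∑ gs) (gs · ds))) N∣) ,
    subst (N ∣_) (sym (sum l (∑ gs))) N∣0
    where dot : ∀ l s g → - (l + l + s) * + 0 + (l * + 1 + (l * ℤ.-1ℤ + g)) ≡ g
          dot = solve-∀
          sum : ∀ l s → - (l + l + s) + (l + (l + s)) ≡ + 0
          sum = solve-∀

  module _ (2<n : 2 ℕ.< n) where

    private
      1<n : 1 ℕ.< n
      1<n = ℕ.<-trans (ℕ.n<1+n 1) 2<n

    -- t − (r + 1) and t − (r + 2) cannot both vanish, as 1 ≢ 0.
    sumOfNonzero : ∀ {ℓ} → 2 ℕ.≤ ℓ → ∀ t → SumOfNonzero ℓ t
    sumOfNonzero {suc zero} (s≤s ()) t
    sumOfNonzero {suc (suc r)} _ t with N ∣? (t - + suc r)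
    ... | no t-1-r≢0 =
      t - + suc r ∷ replicate (suc r) (+ 1) , cong suc (List.length-replicate (suc r)) ,
      t-1-r≢0 ∷ All.replicate⁺ (suc r) (1≢0 1<n) ,
      trans (cong (λ s → t - + suc r + s) (∑-replicate-1 (suc r))) (lemma t (+ suc r))
      where lemma : ∀ t a → t - a + a ≡ t
            lemma = solve-∀
    ... | yes N∣t-1-r =
      t - + suc (suc r) ∷ + 2 ∷ replicate r (+ 1) , cong (λ k → suc (suc k)) (List.length-replicate r) ,
      (λ N∣t-2-r → 1≢0 1<n (subst (N ∣_) (lemma₁ t (+ r)) (∣m∣n⇒∣m-n N∣t-1-r N∣t-2-r))) ∷ 2≢0 2<n ∷
      All.replicate⁺ r (1≢0 1<n) ,
      trans (cong (λ s → t - + suc (suc r) + (+ 2 + s)) (∑-replicate-1 r)) (lemma₂ t (+ r))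
      where lemma₁ : ∀ t r → (t - (+ 1 + r)) - (t - (+ 2 + r)) ≡ + 1
            lemma₁ = solve-∀
            lemma₂ : ∀ t r → t - (+ 2 + r) + (+ 2 + r) ≡ t
            lemma₂ = solve-∀

    -- Either some pairwise sum is nonzero, or d + e + 2f = (d + f) + (e + f) vanishes.
    ZeroSum-triple : ∀ {d e f} → Nonzeroₙ d → Nonzeroₙ e → Nonzeroₙ f → ZeroSum (d ∷ e ∷ f ∷ [])
    ZeroSum-triple {d} {e} {f} d≢0 e≢0 f≢0 with N ∣? (e + f) | N ∣? (d + f) | N ∣? (d + e)
    ... | no e+f≢0 | _         | _ = ZeroSum-triple′ d≢0 e+f≢0
    ... | yes _    | no d+f≢0  | _ = proj₁ (ZeroSum-↭ (swap e d ↭.refl) (ZeroSum-triple′ e≢0 d+f≢0))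
    ... | yes _    | yes _     | no d+e≢0 =
      proj₁ (ZeroSum-↭ (↭-sym (↭.shift f (d ∷ e ∷ []) [])) (ZeroSum-triple′ f≢0 d+e≢0))
    ... | yes N∣e+f | yes N∣d+f | yes _ =
      zeroSum (+ 1 ∷ + 1 ∷ + 2 ∷ []) refl (1≢0 1<n ∷ 1≢0 1<n ∷ 2≢0 2<n ∷ [])
              (subst (N ∣_) (sym (lemma d e f)) (∣m∣n⇒∣m+n N∣d+f N∣e+f))
      where lemma : ∀ d e f → + 1 * d + (+ 1 * e + (+ 2 * f + + 0)) ≡ (d + f) + (e + f)
            lemma = solve-∀

    zeroSum-of-nonzero : ∀ {ds} → All Nonzeroₙ ds → 2 ℕ.≤ length ds → ZeroSum ds
    zeroSum-of-nonzero []        ()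
    zeroSum-of-nonzero (_ ∷ [])  (s≤s ())
    zeroSum-of-nonzero (d≢0 ∷ e≢0 ∷ []) _ = ZeroSum-pair d≢0 e≢0
    zeroSum-of-nonzero (d≢0 ∷ e≢0 ∷ f≢0 ∷ []) _ = ZeroSum-triple d≢0 e≢0 f≢0
    zeroSum-of-nonzero (d≢0 ∷ e≢0 ∷ ds≢0@(_ ∷ _ ∷ _)) _ =
      ZeroSum-++ (ZeroSum-pair d≢0 e≢0) (zeroSum-of-nonzero ds≢0 (s≤s (s≤s z≤n)))

    -- The weight λ on 1 and on −1 is 1 or 2, chosen so that the weight −(2λ + ∑ gs) on 0 is nonzero.
    Balanced-0∷1∷-1∷ : ∀ {ds} → ZeroSum ds → Balanced (+ 0 ∷ + 1 ∷ ℤ.-1ℤ ∷ ds)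
    Balanced-0∷1∷-1∷ z with N ∣? (+ 2 + ∑ (weights z))
    ... | no 2+s≢0  = Balanced-0∷1∷-1∷′ z (+ 1) (1≢0 1<n) 2+s≢0
    ... | yes N∣2+s = Balanced-0∷1∷-1∷′ z (+ 2) (2≢0 2<n)
        (λ N∣4+s → 2≢0 2<n (subst (N ∣_) (lemma (∑ (weights z))) (∣m∣n⇒∣m-n N∣4+s N∣2+s)))
      where lemma : ∀ s → (+ 2 + + 2 + s) - (+ 2 + s) ≡ + 2
            lemma = solve-∀

module FinSequences (n : ℕ) .{{_ : NonZero n}} where

  open Residues n
  open ZeroSums n

  AZSₙ : List (Fin n) → Set
  AZSₙ = AZS n (Nonzero' n)

  ABZSₙ : List (Fin n) → Set
  ABZSₙ = ABZS n (Nonzero' n) (One n)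

  ABZS⇒AZS : ∀ {T} → ABZSₙ T → AZSₙ T
  ABZS⇒AZS (as , len , as≢0 , zero-sum , _) = as , len , as≢0 , zero-sum

  ⟦_⟧* : List (Fin n) → List ℤ
  ⟦_⟧* = map ⟦_⟧

  IsZeroZ⇒N∣ : ∀ {k} → IsZeroZ n k → N ∣ + k
  IsZeroZ⇒N∣ {k} k%n≡0 = ∣ᵤ⇒∣ (ℕ.m%n≡0⇒n∣m k n k%n≡0)

  N∣⇒IsZeroZ : ∀ {k} → N ∣ + k → IsZeroZ n k
  N∣⇒IsZeroZ {k} N∣k = ℕ.n∣m⇒m%n≡0 k n (∣⇒∣ᵤ N∣k)

  wsum≡· : ∀ as xs → + wsum n as xs ≡ ⟦ as ⟧* · ⟦ xs ⟧*
  wsum≡· []       xs       = refl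
  wsum≡· (a ∷ as) []       = refl
  wsum≡· (a ∷ as) (x ∷ xs) =
    trans (ℤ.pos-+ (toℕ a ℕ.* toℕ x) (wsum n as xs)) (cong₂ _+_ (ℤ.pos-* (toℕ a) (toℕ x)) (wsum≡· as xs))

  Nonzero'⇒Nonzeroₙ : ∀ {a} → Nonzero' n a → Nonzeroₙ ⟦ a ⟧
  Nonzero'⇒Nonzeroₙ {a} a≢0 = Nonzeroₙ-+ (ℕ.n≢0⇒n>0 a≢0) (Fin.toℕ<n a)

  Nonzeroₙ⇒Nonzero' : ∀ {w} → Nonzeroₙ w → Nonzero' n (residue w)
  Nonzeroₙ⇒Nonzero' {w} w≢0 r≡0 = w≢0 (∣-resp-≡ₙ (⟦residue⟧ w) (subst (λ k → N ∣ + k) (sym r≡0) N∣0))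

  ⟦residue⟧* : ∀ ws → Pointwise _≡ₙ_ ⟦ map residue ws ⟧* ws
  ⟦residue⟧* []       = []
  ⟦residue⟧* (w ∷ ws) = ⟦residue⟧ w ∷ ⟦residue⟧* ws

  One⇒≡ₙ1 : ∀ {bs} → All (One n) bs → Pointwise _≡ₙ_ ⟦ bs ⟧* (replicate (length bs) (+ 1))
  One⇒≡ₙ1 []                   = []
  One⇒≡ₙ1 {b ∷ _} (b≡1 ∷ bs≡1) =
    subst (λ k → + k ≡ₙ + 1) (trans (Fin.toℕ-fromℕ< (ℕ.m%n<n 1 n)) (sym b≡1)) (⟦mod⟧ 1) ∷ One⇒≡ₙ1 bs≡1

  wsum-One : ∀ {bs} as → All (One n) bs → length bs ≡ length as → + wsum n bs as ≡ₙ ∑ ⟦ as ⟧*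
  wsum-One {bs} as bs≡1 len = begin
    + wsum n bs as                              ≡⟨ wsum≡· bs as ⟩
    ⟦ bs ⟧* · ⟦ as ⟧*                           ≈⟨ ·-cong (One⇒≡ₙ1 bs≡1) (Pointwise.refl ≡ₙ-refl) ⟩
    replicate (length bs) (+ 1) · ⟦ as ⟧*        ≡⟨ ·-comm (replicate (length bs) (+ 1)) ⟦ as ⟧* ⟩
    ⟦ as ⟧* · replicate (length bs) (+ 1)        ≡⟨ ·-replicate ⟦ as ⟧* (+ 1) |as|≡|bs| ⟩
    ∑ ⟦ as ⟧* * + 1                             ≡⟨ ℤ.*-identityʳ (∑ ⟦ as ⟧*) ⟩
    ∑ ⟦ as ⟧*                                   ∎
    where open ≡ₙ-Reasoning
          |as|≡|bs| = trans (List.length-map ⟦_⟧ as) (sym len)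

  AZS⇒ZeroSum : ∀ {xs} → AZSₙ xs → ZeroSum ⟦ xs ⟧*
  AZS⇒ZeroSum {xs} (as , len , as≢0 , zero-sum) =
    zeroSum ⟦ as ⟧* (trans (List.length-map ⟦_⟧ as) (trans len (sym (List.length-map ⟦_⟧ xs))))
            (All.map⁺ (All.map Nonzero'⇒Nonzeroₙ as≢0))
            (subst (N ∣_) (wsum≡· as xs) (IsZeroZ⇒N∣ zero-sum))

  ZeroSum⇒AZS : ∀ {xs} → ZeroSum ⟦ xs ⟧* → AZSₙ xs
  ZeroSum⇒AZS {xs} (zeroSum ws len ws≢0 N∣) =
    map residue ws , trans (List.length-map residue ws) (trans len (List.length-map ⟦_⟧ xs)) ,
    All.map⁺ (All.map Nonzeroₙ⇒Nonzero' ws≢0) ,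
    N∣⇒IsZeroZ (subst (N ∣_) (sym (wsum≡· (map residue ws) xs))
                      (∣-resp-≡ₙ (·-cong (≡ₙ-sym* (⟦residue⟧* ws)) (Pointwise.refl ≡ₙ-refl)) N∣))
    where ≡ₙ-sym* = Pointwise.symmetric ≡ₙ-sym

  ABZS⇒Balanced : ∀ {xs} → ABZSₙ xs → Balanced ⟦ xs ⟧*
  ABZS⇒Balanced (as , len , as≢0 , zero-sum , bs , len-bs , bs≡1 , ∑≡0) =
    AZS⇒ZeroSum (as , len , as≢0 , zero-sum) ,
    ∣-resp-≡ₙ (wsum-One as bs≡1 len-bs) (IsZeroZ⇒N∣ ∑≡0)

  Balanced⇒ABZS : ∀ {xs} → Balanced ⟦ xs ⟧* → ABZSₙ xs
  Balanced⇒ABZS (z@(zeroSum ws _ _ _) , N∣∑) =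
    let as , len , as≢0 , zero-sum = ZeroSum⇒AZS z
        ones≡1 = All.replicate⁺ (length as) (Fin.toℕ-fromℕ< (ℕ.m%n<n 1 n))
    in as , len , as≢0 , zero-sum ,
       replicate (length as) (1 ℕ.mod n) , List.length-replicate (length as) , ones≡1 ,
       N∣⇒IsZeroZ (∣-resp-≡ₙ (≡ₙ-sym (≡ₙ-trans (wsum-One as ones≡1 (List.length-replicate (length as)))
                                             (∑-cong (⟦residue⟧* ws))))
                             N∣∑)

  ⟦addZ⟧* : ∀ x xs → Pointwise _≡ₙ_ (map (_+_ ⟦ x ⟧) ⟦ xs ⟧*) ⟦ map (addZ n x) xs ⟧*
  ⟦addZ⟧* x []       = []
  ⟦addZ⟧* x (y ∷ xs) = ≡ₙ-sym (⟦addZ⟧ x y) ∷ ⟦addZ⟧* x xs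

  Balanced-addZ : ∀ x {xs} → Balanced ⟦ xs ⟧* → Balanced ⟦ map (addZ n x) xs ⟧*
  Balanced-addZ x {xs} b = Balanced-cong (⟦addZ⟧* x xs) (Balanced-translate ⟦ x ⟧ b)

  ⟦replicate⟧ : ∀ {x a} k → ⟦ x ⟧ ≡ₙ a → Pointwise _≡ₙ_ ⟦ replicate k x ⟧* (replicate k a)
  ⟦replicate⟧ zero    _   = []
  ⟦replicate⟧ (suc k) x≡a = x≡a ∷ ⟦replicate⟧ k x≡a

module _ (n : ℕ) .{{_ : NonZero n}} {Z : List (Fin n) → Set} where

  IsE-unique : ∀ {j k} → IsE n Z j → IsE n Z k → j ≡ k
  IsE-unique {j} {k} (0<j , good-j , least-j) (0<k , good-k , least-k) with ℕ.<-cmp j k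
  ... | tri< j<k _ _ = contradiction good-j (least-k j 0<j j<k)
  ... | tri≈ _ j≡k _ = j≡k
  ... | tri> _ _ k<j = contradiction good-k (least-j k 0<k k<j)

  -- A shorter sequence is covered by a prefix of S, whose only candidate subsequence of length n is S.
  IsE-suc : Good n Z (suc n) → ∀ S → length S ≡ n → ¬ Z S → IsE n Z (suc n)
  IsE-suc good S len ¬ZS = s≤s z≤n , good , λ j _ j<1+n good-j → ¬ZS (covered j j<1+n good-j)
    where
      covered : ∀ j → j < suc n → Good n Z j → Z S
      covered j (s≤s j≤n) good-j
        with T , T⊆S′ , lenT , ZT ← good-j (take j S) (trans (List.length-take j S)
                                                             (ℕ.m≤n⇒m⊓n≡m (subst (j ≤_) (sym len) j≤n)))
        = subst Z (⊆∧length≡⇒≡ (⊆-trans T⊆S′ (⊆.take-⊆ j S)) (trans lenT (sym len))) ZT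

  Extremal⇔ : IsE n Z (suc n) → ∀ S → Extremal n Z S ⇔ (length S ≡ n × ¬ Z S)
  Extremal⇔ E S = mk⇔
    (λ (k , Eₖ , len , ¬sub) → ℕ.suc-injective (trans len (IsE-unique Eₖ E)) ,
                               λ ZS → ¬sub (S , ⊆-refl , ℕ.suc-injective (trans len (IsE-unique Eₖ E)) , ZS))
    (λ (len , ¬ZS) → suc n , E , cong suc len ,
                     λ (T , T⊆S , lenT , ZT) → ¬ZS (subst Z (⊆∧length≡⇒≡ T⊆S (trans lenT (sym len))) ZT))

Good-mono : ∀ {n} .{{_ : NonZero n}} {Z Z′ : List (Fin n) → Set} {k} →
            (∀ {T} → Z T → Z′ T) → Good n Z k → Good n Z′ k
Good-mono Z⇒Z′ good S len with T , T⊆S , lenT , ZT ← good S len = T , T⊆S , lenT , Z⇒Z′ ZT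

module Classification (n : ℕ) .{{_ : NonZero n}} where

  open Residues n
  open ZeroSums n
  open FinSequences n

  AlmostConstant : List (Fin n) → Set
  AlmostConstant S = ∃₂ λ v c → ∃ λ k → S ↭ v ∷ replicate k c

  Dichotomy : Set
  Dichotomy = ∀ S → length S ≡ n → Balanced ⟦ S ⟧* ⊎ AlmostConstant S

  DistinctBalanced : Set
  DistinctBalanced = ∀ {S} → Unique S → length S ≡ n → Balanced ⟦ S ⟧*

  module _ (2<n : 2 ℕ.< n) where

    -- Translating by −c turns the copies of c into zeros, whose weights can absorb any total weight.
    Balanced-block : ∀ {j} c os → 2 ℕ.≤ j → 2 ℕ.≤ length os → All (_≢ c) os →
                     Balanced ⟦ replicate j c ++ os ⟧*
    Balanced-block {j} c os 2≤j 2≤|os| os≢c =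
      subst Balanced shape (Balanced-translate ⟦ c ⟧ (Balanced-zeros-++ z (sumOfNonzero 2<n 2≤j _)))
      where
        ds = map (λ o → ⟦ o ⟧ - ⟦ c ⟧) os
        z = zeroSum-of-nonzero 2<n
              (All.map⁺ (All.map (λ {o} o≢c N∣ → o≢c (⟦⟧-injective {o} {c} (≡ₙ-intro N∣))) os≢c))
              (subst (2 ℕ.≤_) (sym (List.length-map _ os)) 2≤|os|)
        shift-back : ∀ o → ⟦ c ⟧ + (⟦ o ⟧ - ⟦ c ⟧) ≡ ⟦ o ⟧
        shift-back o = lemma ⟦ c ⟧ ⟦ o ⟧
          where lemma : ∀ c o → c + (o - c) ≡ o
                lemma = solve-∀
        open ≡-Reasoning
        shape : map (_+_ ⟦ c ⟧) (replicate j (+ 0) ++ ds) ≡ ⟦ replicate j c ++ os ⟧*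
        shape = begin
          map (_+_ ⟦ c ⟧) (replicate j (+ 0) ++ ds)
            ≡⟨ List.map-++ _ (replicate j (+ 0)) ds ⟩
          map (_+_ ⟦ c ⟧) (replicate j (+ 0)) ++ map (_+_ ⟦ c ⟧) ds
            ≡⟨ cong₂ _++_ (trans (List.map-replicate _ j (+ 0)) (cong (replicate j) (ℤ.+-identityʳ ⟦ c ⟧)))
                          (trans (sym (List.map-∘ os)) (List.map-cong shift-back os)) ⟩
          replicate j ⟦ c ⟧ ++ ⟦ os ⟧*
            ≡⟨ cong (_++ ⟦ os ⟧*) (List.map-replicate ⟦_⟧ j c) ⟨
          ⟦ replicate j c ⟧* ++ ⟦ os ⟧*
            ≡⟨ List.map-++ ⟦_⟧ (replicate j c) os ⟨
          ⟦ replicate j c ++ os ⟧* ∎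

    classify-repeated : ∀ {S} d j os → S ↭ replicate (suc (suc j)) d ++ os → All (_≢ d) os →
               Balanced ⟦ S ⟧* ⊎ AlmostConstant S
    classify-repeated d j []             p _ =
      inj₂ (d , d , suc j , ↭.trans p (↭.↭-reflexive (List.++-identityʳ _)))
    classify-repeated d j (o ∷ [])       p _ =
      inj₂ (o , d , suc (suc j) , ↭.trans p (↭.++-comm (replicate (suc (suc j)) d) (o ∷ [])))
    classify-repeated d j os@(_ ∷ _ ∷ _) p os≢d =
      inj₁ (Balanced-↭ (↭.map⁺ ⟦_⟧ (↭-sym p)) (Balanced-block d os (s≤s (s≤s z≤n)) (s≤s (s≤s z≤n)) os≢d))

    dichotomy : DistinctBalanced → Dichotomy
    dichotomy distinct S len with unique-or-duplicate Fin._≟_ S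
    ... | inj₁ u = inj₁ (distinct u len)
    ... | inj₂ (d , ys , S↭) with j , os , ys↭ , os≢d ← ↭-replicate-++ Fin._≟_ d ys =
      classify-repeated d j os (↭.trans S↭ (prep d (prep d ys↭))) os≢d

  Balanced-↭-replicate : 1 ℕ.< n → ∀ {T} c → T ↭ replicate n c → Balanced ⟦ T ⟧*
  Balanced-↭-replicate 1<n c p =
    Balanced-↭ (↭.map⁺ ⟦_⟧ (↭-sym p))
      (subst Balanced (sym (List.map-replicate ⟦_⟧ n c)) (Balanced-replicate 1<n ⟦ c ⟧))

  Balanced⊆⇒HasSub : ∀ {T S} → T ⊆ S → length T ≡ n → Balanced ⟦ T ⟧* → HasSubLenN n ABZSₙ S
  Balanced⊆⇒HasSub T⊆S lenT b = _ , T⊆S , lenT , Balanced⇒ABZS b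

  module _ (3<n : 3 ℕ.< n) where

    private
      2<n = ℕ.<-trans (ℕ.n<1+n 2) 3<n
      1<n = ℕ.<-trans (ℕ.n<1+n 1) 2<n

    private
      Balanced∷⊆⇒HasSub : ∀ s {S ys T} → ys ⊆ S → s ∷ ys ↭ T → length T ≡ n → Balanced ⟦ T ⟧* →
                HasSubLenN n ABZSₙ (s ∷ S)
      Balanced∷⊆⇒HasSub s ys⊆S p lenT b =
        Balanced⊆⇒HasSub (refl ∷ ys⊆S) (trans (↭.↭-length p) lenT) (Balanced-↭ (↭.map⁺ ⟦_⟧ (↭-sym p)) b)

    HasSub-∷-almostConstant : ∀ s {S v c k} → S ↭ v ∷ replicate k c → suc k ≡ n → HasSubLenN n ABZSₙ (s ∷ S)
    HasSub-∷-almostConstant s {S} {v} {c} {k} S↭ 1+k≡n with v Fin.≟ c | s Fin.≟ c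
    ... | yes refl | _ =
      Balanced⊆⇒HasSub (s ∷ʳ ⊆-refl) (trans (↭.↭-length S↭) (trans (cong suc (List.length-replicate k)) 1+k≡n))
            (Balanced-↭-replicate 1<n v (subst (λ m → S ↭ replicate m v) 1+k≡n S↭))
    ... | no v≢c | yes refl with ys , ys⊆S , S↭v∷ys ← ∈⇒⊆×↭ (↭.∈-resp-↭ (↭-sym S↭) (here refl)) =
      Balanced∷⊆⇒HasSub s ys⊆S (subst (λ m → s ∷ ys ↭ replicate m s) 1+k≡n (prep s ys↭))
              (List.length-replicate n) (Balanced-↭-replicate 1<n s ↭.refl)
      where ys↭ : ys ↭ replicate k s
            ys↭ = ↭.drop-∷ (↭.trans (↭-sym S↭v∷ys) S↭)
    HasSub-∷-almostConstant s {k = zero} S↭ 1≡n | no _ | no _ = contradiction 1≡n (ℕ.<⇒≢ 1<n)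
    HasSub-∷-almostConstant s {S} {v} {c} {suc k} S↭ 2+k≡n | no v≢c | no s≢c
      with ys , ys⊆S , S↭c∷ys ← ∈⇒⊆×↭ (↭.∈-resp-↭ (↭-sym S↭) (there (here refl))) =
      Balanced∷⊆⇒HasSub s ys⊆S (prep s ys↭) (trans (cong (λ m → suc (suc m)) (List.length-replicate k)) 2+k≡n)
        (Balanced-↭ (↭.map⁺ ⟦_⟧ (↭.++-comm (replicate k c) (s ∷ v ∷ [])))
          (Balanced-block 2<n c (s ∷ v ∷ []) 2≤k (s≤s (s≤s z≤n)) (s≢c ∷ v≢c ∷ [])))
      where ys↭ : ys ↭ v ∷ replicate k c
            ys↭ = ↭.drop-∷ (↭.trans (↭-sym S↭c∷ys) (↭.trans S↭ (swap v c ↭.refl)))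
            2≤k : 2 ℕ.≤ k
            2≤k = ℕ.≤-pred (ℕ.≤-pred (subst (3 ℕ.<_) (sym 2+k≡n) 3<n))

    Good-of-dichotomy : Dichotomy → Good n ABZSₙ (suc n)
    Good-of-dichotomy dich (s ∷ S) 1+|S|≡1+n with dich S (ℕ.suc-injective 1+|S|≡1+n)
    ... | inj₁ b = Balanced⊆⇒HasSub (s ∷ʳ ⊆-refl) (ℕ.suc-injective 1+|S|≡1+n) b
    ... | inj₂ (v , c , k , S↭) =
      HasSub-∷-almostConstant s S↭
        (trans (cong suc (sym (List.length-replicate k))) (trans (sym (↭.↭-length S↭)) (ℕ.suc-injective 1+|S|≡1+n)))

module ModFour where
  open Residues 4
  open ZeroSums 4
  open FinSequences 4
  open Classification 4

  Balanced-0∷1∷3∷ : ∀ M → All (_∉ Fin.zero ∷ Fin.suc Fin.zero ∷ fromℕ 3 ∷ []) M → length M ≡ 1 →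
                    Balanced ⟦ Fin.zero ∷ Fin.suc Fin.zero ∷ fromℕ 3 ∷ M ⟧*
  Balanced-0∷1∷3∷ (Fin.zero ∷ []) (m∉ ∷ []) _ = contradiction (here refl) m∉
  Balanced-0∷1∷3∷ (Fin.suc Fin.zero ∷ []) (m∉ ∷ []) _ = contradiction (there (here refl)) m∉
  Balanced-0∷1∷3∷ (Fin.suc (Fin.suc (Fin.suc Fin.zero)) ∷ []) (m∉ ∷ []) _ =
    contradiction (there (there (here refl))) m∉
  Balanced-0∷1∷3∷ (Fin.suc (Fin.suc Fin.zero) ∷ []) _ _ =
    zeroSum (+ 2 ∷ + 2 ∷ + 2 ∷ + 2 ∷ []) refl (2≢0₄ ∷ 2≢0₄ ∷ 2≢0₄ ∷ 2≢0₄ ∷ []) (divides (+ 3) refl) ,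
    divides (+ 2) refl
    where 2≢0₄ = 2≢0 (s≤s (s≤s (s≤s z≤n)))

  distinctBalanced : DistinctBalanced
  distinctBalanced {S} u len
    with M , S↭ , M∉ ← extract-unique u (((λ ()) ∷ (λ ()) ∷ []) ∷ ((λ ()) ∷ []) ∷ [] ∷ [])
                                        (All.universal (unique⇒complete u len) _) =
    Balanced-↭ (↭.↭-sym (↭.map⁺ ⟦_⟧ S↭))
      (Balanced-0∷1∷3∷ M M∉ (ℕ.suc-injective (ℕ.suc-injective (ℕ.suc-injective
                              (trans (sym (↭.↭-length S↭)) len)))))

module ModFivePlus (k : ℕ) where
  n : ℕ
  n = 5 ℕ.+ k

  open Residues n
  open ZeroSums n
  open FinSequences n
  open Classification n

  private
    2<n : 2 ℕ.< n
    2<n = s≤s (s≤s (s≤s z≤n))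

  last : Fin n
  last = fromℕ (4 ℕ.+ k)

  ⟦last⟧ : ⟦ last ⟧ ≡ₙ ℤ.-1ℤ
  ⟦last⟧ rewrite Fin.toℕ-fromℕ (4 ℕ.+ k) =
    ≡ₙ-intro (divides (+ 1) (cong +_ (trans (ℕ.+-comm (4 ℕ.+ k) 1) (sym (ℕ.*-identityˡ n)))))

  private
    corners : List (Fin n)
    corners = Fin.zero ∷ Fin.suc Fin.zero ∷ last ∷ []

  Balanced-corners-++ : ∀ M → All (_∉ corners) M → 2 ℕ.≤ length M → Balanced ⟦ corners ++ M ⟧*
  Balanced-corners-++ M M∉ 2≤|M| =
    Balanced-cong (≡ₙ-refl ∷ ≡ₙ-refl ∷ ≡ₙ-sym ⟦last⟧ ∷ Pointwise.refl ≡ₙ-refl)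
      (Balanced-0∷1∷-1∷ 2<n (zeroSum-of-nonzero 2<n M≢0 (subst (2 ℕ.≤_) (sym (List.length-map ⟦_⟧ M)) 2≤|M|)))
    where M≢0 = All.map⁺ (All.map (λ m∉ → Nonzero'⇒Nonzeroₙ (λ m≡0 → m∉ (here (Fin.toℕ-injective m≡0)))) M∉)

  distinctBalanced : DistinctBalanced
  distinctBalanced {S} u len
    with M , S↭ , M∉ ← extract-unique u (((λ ()) ∷ (λ ()) ∷ []) ∷ ((λ ()) ∷ []) ∷ [] ∷ [])
                                        (All.universal (unique⇒complete u len) _) =
    Balanced-↭ (↭.↭-sym (↭.map⁺ ⟦_⟧ S↭))
      (Balanced-corners-++ M M∉ (subst (2 ℕ.≤_) (sym |M|≡2+k) (ℕ.m≤m+n 2 k)))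
    where |M|≡2+k : length M ≡ 2 ℕ.+ k
          |M|≡2+k = ℕ.suc-injective (ℕ.suc-injective (ℕ.suc-injective (trans (sym (↭.↭-length S↭)) len)))

module ModTwo where
  open Residues 2
  open ZeroSums 2
  open FinSequences 2
  open Classification 2

  dichotomy₂ : Dichotomy
  dichotomy₂ (x ∷ y ∷ []) _ = inj₂ (x , y , 1 , ↭.refl)

  ≢∧≢⇒≡ : ∀ {a b c : Fin 2} → a ≢ b → a ≢ c → b ≡ c
  ≢∧≢⇒≡ {b = Fin.zero}         {Fin.zero}         _ _ = refl
  ≢∧≢⇒≡ {b = Fin.suc Fin.zero} {Fin.suc Fin.zero} _ _ = refl
  ≢∧≢⇒≡ {Fin.zero}         {Fin.zero}         {Fin.suc Fin.zero} a≢b _   = contradiction refl a≢b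
  ≢∧≢⇒≡ {Fin.suc Fin.zero} {Fin.suc Fin.zero} {Fin.zero}         a≢b _   = contradiction refl a≢b
  ≢∧≢⇒≡ {Fin.zero}         {Fin.suc Fin.zero} {Fin.zero}         _   a≢c = contradiction refl a≢c
  ≢∧≢⇒≡ {Fin.suc Fin.zero} {Fin.zero}         {Fin.suc Fin.zero} _   a≢c = contradiction refl a≢c

  Balanced-x∷x : ∀ x → Balanced ⟦ x ∷ x ∷ [] ⟧*
  Balanced-x∷x x = Balanced-↭-replicate (s≤s (s≤s z≤n)) x ↭.refl

  good₂ : Good 2 ABZSₙ 3
  good₂ (a ∷ b ∷ c ∷ []) _ with a Fin.≟ b | a Fin.≟ c
  ... | yes refl | _        = Balanced⊆⇒HasSub (refl ∷ refl ∷ c ∷ʳ []) refl (Balanced-x∷x a)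
  ... | no _     | yes refl = Balanced⊆⇒HasSub (refl ∷ b ∷ʳ refl ∷ []) refl (Balanced-x∷x a)
  ... | no a≢b   | no a≢c with refl ← ≢∧≢⇒≡ a≢b a≢c =
    Balanced⊆⇒HasSub (a ∷ʳ refl ∷ refl ∷ []) refl (Balanced-x∷x b)

module Characterisation (n : ℕ) .{{_ : NonZero n}} (1<n : 1 ℕ.< n) where
  open Residues n
  open ZeroSums n
  open FinSequences n
  open Classification n

  sumOfNonzero-pred : ∀ {k} → suc k ≡ n → ∀ t → Nonzeroₙ t → SumOfNonzero k t
  sumOfNonzero-pred {zero}          1≡n   _ _   = contradiction 1≡n (ℕ.<⇒≢ 1<n)
  sumOfNonzero-pred {suc zero}      _     t t≢0 = t ∷ [] , refl , t≢0 ∷ [] , ℤ.+-identityʳ t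
  sumOfNonzero-pred {suc (suc k)}   3+k≡n t _   =
    sumOfNonzero (subst (2 ℕ.<_) 3+k≡n (s≤s (s≤s (s≤s z≤n)))) (s≤s (s≤s z≤n)) t

  translate-free : ∀ {T} x → ¬ AZSₙ T → ¬ ABZSₙ (map (addZ n x) T)
  translate-free {T} x ¬AT ab = ¬AT (ZeroSum⇒AZS (proj₁ (subst (λ U → Balanced ⟦ U ⟧*)
    (map-cancelˡ (addZ-neg-cancelˡ x) T) (Balanced-addZ (neg x) (ABZS⇒Balanced ab)))))

  free⇒translate-of-free : Dichotomy → ∀ {S} → length S ≡ n → ¬ ABZSₙ S →
                           ∃₂ λ T x → ¬ AZSₙ T × S ≡ map (addZ n x) T
  free⇒translate-of-free dich {S} len ¬ABS with dich S len
  ... | inj₁ b = contradiction (Balanced⇒ABZS b) ¬ABS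
  ... | inj₂ (v , c , k , S↭) = T , c , ¬AT , sym (map-cancelˡ (addZ-neg-cancelʳ c) S)
    where
      T = map (addZ n (neg c)) S
      v′ = addZ n (neg c) v
      T↭ : ⟦ T ⟧* ↭ ⟦ v′ ∷ map (addZ n (neg c)) (replicate k c) ⟧*
      T↭ = ↭.map⁺ ⟦_⟧ (↭.map⁺ (addZ n (neg c)) S↭)
      c-c≡0 : ⟦ addZ n (neg c) c ⟧ ≡ₙ + 0
      c-c≡0 = ≡ₙ-trans (⟦addZ⟧ (neg c) c)
                (≡ₙ-trans (+-cong (⟦residue⟧ (- ⟦ c ⟧)) (≡ₙ-refl {⟦ c ⟧})) (≡⇒≡ₙ (ℤ.+-inverseˡ ⟦ c ⟧)))
      zeros : Pointwise _≡ₙ_ ⟦ v′ ∷ map (addZ n (neg c)) (replicate k c) ⟧* (⟦ v′ ⟧ ∷ replicate k (+ 0))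
      zeros = ≡ₙ-refl ∷ subst (λ U → Pointwise _≡ₙ_ ⟦ U ⟧* (replicate k (+ 0)))
                              (sym (List.map-replicate _ k c)) (⟦replicate⟧ k c-c≡0)
      1+k≡n = trans (cong suc (sym (List.length-replicate k))) (trans (sym (↭.↭-length S↭)) len)
      ¬AT : ¬ AZSₙ T
      ¬AT aT = ¬ABS (Balanced⇒ABZS (subst (λ U → Balanced ⟦ U ⟧*) (map-cancelˡ (addZ-neg-cancelʳ c) S)
                                           (Balanced-addZ c balanced-T)))
        where
          zeroSum-v′∷zeros : ZeroSum (⟦ v′ ⟧ ∷ replicate k (+ 0))
          zeroSum-v′∷zeros = ZeroSum-cong zeros (proj₁ (ZeroSum-↭ T↭ (AZS⇒ZeroSum aT)))
          balanced-T : Balanced ⟦ T ⟧*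
          balanced-T = Balanced-↭ (↭-sym T↭) (Balanced-cong (Pointwise.symmetric ≡ₙ-sym zeros)
                         (Balanced-∷-zeros (sumOfNonzero-pred 1+k≡n) zeroSum-v′∷zeros))

  unit∷zeros : List (Fin n)
  unit∷zeros = 1 mod n ∷ replicate (ℕ.pred n) (0 mod n)

  length-unit∷zeros : length unit∷zeros ≡ n
  length-unit∷zeros = trans (cong suc (List.length-replicate (ℕ.pred n))) (ℕ.suc-pred n)

  ¬AZS-unit∷zeros : ¬ AZSₙ unit∷zeros
  ¬AZS-unit∷zeros a = ¬ZeroSum-1∷zeros (ℕ.pred n)
    (ZeroSum-cong (⟦mod⟧ 1 ∷ ⟦replicate⟧ (ℕ.pred n) (⟦mod⟧ 0)) (AZS⇒ZeroSum a))

  module _ (good : Good n ABZSₙ (suc n)) where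

    E-ABZS : IsE n ABZSₙ (suc n)
    E-ABZS = IsE-suc n good unit∷zeros length-unit∷zeros (¬AZS-unit∷zeros ∘ ABZS⇒AZS)

    E-AZS : IsE n AZSₙ (suc n)
    E-AZS = IsE-suc n (Good-mono ABZS⇒AZS good) unit∷zeros length-unit∷zeros ¬AZS-unit∷zeros

    ExtremalAB⇔ : ∀ S → ExtremalAB n (Nonzero' n) (One n) S ⇔ (length S ≡ n × ¬ ABZSₙ S)
    ExtremalAB⇔ = Extremal⇔ n E-ABZS

    ExtremalA⇔ : ∀ T → ExtremalA n (Nonzero' n) T ⇔ (length T ≡ n × ¬ AZSₙ T)
    ExtremalA⇔ = Extremal⇔ n E-AZS

    characterisation : Dichotomy → ∀ S →
      ExtremalAB n (Nonzero' n) (One n) S ⇔ (∃ λ T → ExtremalA n (Nonzero' n) T × IsTranslateOf n S T)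
    characterisation dich S = mk⇔ to from
      where
        to : ExtremalAB n (Nonzero' n) (One n) S →
             ∃ λ T → ExtremalA n (Nonzero' n) T × IsTranslateOf n S T
        to extS =
          let len , ¬ABS = Equivalence.to (ExtremalAB⇔ S) extS
              T , x , ¬AT , S≡ = free⇒translate-of-free dich len ¬ABS
          in T , Equivalence.from (ExtremalA⇔ T)
                   (trans (sym (List.length-map _ T)) (trans (cong length (sym S≡)) len) , ¬AT) ,
             x , S≡
        from : (∃ λ T → ExtremalA n (Nonzero' n) T × IsTranslateOf n S T) →
               ExtremalAB n (Nonzero' n) (One n) S
        from (T , extT , x , S≡) =
          let lenT , ¬AT = Equivalence.to (ExtremalA⇔ T) extT
          in Equivalence.from (ExtremalAB⇔ S)
               (trans (cong length S≡) (trans (List.length-map _ T) lenT) ,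
                subst (¬_ ∘ ABZSₙ) (sym S≡) (translate-free x ¬AT))

distinctBalanced : ∀ k → Classification.DistinctBalanced (4 ℕ.+ k)
distinctBalanced zero    = ModFour.distinctBalanced
distinctBalanced (suc k) = ModFivePlus.distinctBalanced k

dichotomy∧good : ∀ n .{{_ : NonZero n}} → 2 ≤ n → n ≢ 3 →
                 Classification.Dichotomy n × Good n (FinSequences.ABZSₙ n) (suc n)
dichotomy∧good 1 (s≤s ()) _
dichotomy∧good 2 _ _ = ModTwo.dichotomy₂ , ModTwo.good₂
dichotomy∧good 3 _ 3≢3 = contradiction refl 3≢3
dichotomy∧good (suc (suc (suc (suc k)))) _ _ =
  dichotomy , Classification.Good-of-dichotomy _ (s≤s (s≤s (s≤s (s≤s z≤n)))) dichotomy
  where dichotomy = Classification.dichotomy _ (s≤s (s≤s (s≤s z≤n))) (distinctBalanced k)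

theorem11 : (n : ℕ) .{{_ : NonZero n}} → 2 ≤ n → n ≢ 3 → (S : List (ℤ_ n)) →
    ExtremalAB n (Nonzero' n) (One n) S ⇔
    (∃ λ T → ExtremalA n (Nonzero' n) T × IsTranslateOf n S T)
theorem11 n 2≤n n≢3 S =
  let dichotomy , good = dichotomy∧good n 2≤n n≢3
  in Characterisation.characterisation n 2≤n good dichotomy S
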